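{- Let $O_e$ and $O_p$ be disjoint finite sets of Boolean variables (the outputs of the environment and of component $p$), and let $\varphi_p$ be an LTL formula over $O_p \cup O_e$. Then there exists a nondeterministic finite automaton over the alphabet $2^{O_e}\times 2^{O_e}$, whose number of states is doubly exponential in the length of $\varphi_p$, that recognizes the prefix distinguishability relation $\rho_{\varphi_p}$, i.e., it accepts a finite word $(x_0,x_0')(x_1,x_1')\cdots(x_{m-1},x_{m-1}')$ if and only if $(x_0x_1\cdots x_{m-1},\,x_0'x_1'\cdots x_{m-1}')\in\rho_{\varphi_p}$.
   Context: A valuation of a set $V$ of Boolean variables is a subset of $V$ (the variables set to true). For traces (finite or infinite sequences of valuations) $x_0x_1\ldots$ over $V$ and $y_0y_1\ldots$ over a disjoint set $V'$ of the same length, $x_0x_1\ldots\sqcup y_0y_1\ldots=(x_0\cup y_0)(x_1\cup y_1)\ldots$. For a trace $\pi$, $\pi[0\ldots n]$ denotes its prefix up to index $n$. A finite trace $\sigma$ is a bad prefix of an LTL formula $\varphi$ if no infinite extension $\sigma\cdot\sigma'$ satisfies $\varphi$; for a finite trace $\sigma$ of length $n$, $\sigma\vDash_n\varphi$ means $\sigma$ is not a bad prefix of $\varphi$. The prefix distinguishability relation $\rho_{\varphi_p}$ is the set of pairs $(\pi,\pi')\in(2^{O_e})^m\times(2^{O_e})^m$, for some $m\in\mathbb N$, such that (i) for every $\pi_p\in(2^{O_p})^m$, $\pi\sqcup\pi_p\nvDash_m\varphi_p$ or $\pi'\sqcup\pi_p\nvDash_m\varphi_p$; and (ii) for every $n<m$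 there exists $\pi_p'\in(2^{O_p})^n$ with $\pi[0\ldots n]\sqcup\pi_p'\vDash_n\varphi_p$ and $\pi'[0\ldots n]\sqcup\pi_p'\vDash_n\varphi_p$. -}

module Defs where

open import Data.Nat using (ℕ; zero; suc; _+_; _≤_; _<_)
open import Data.Fin using (Fin; zero; suc; inject₁; fromℕ; inject≤)
open import Data.Bool using (Bool; true; false)
open import Data.Sum using (_⊎_; inj₁; inj₂)
open import Data.Product using (Σ; ∃; ∃-syntax; _×_; _,_; proj₁; proj₂)
open import Relation.Nullary using (¬_)
open import Data.Unit using (⊤)
open import Relation.Binary.PropositionalEquality using (_≡_)
open import Data.Nat.Properties using (<⇒≤)

-- Valuations: a valuation of a set V of Boolean variables is a subset
-- of V, represented by its characteristic function.

Val : Set → Set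
Val V = V → Bool

FinTrace : Set → ℕ → Set
FinTrace V m = Fin m → Val V

InfTrace : Set → Set
InfTrace V = ℕ → Val V

-- The join ⊔ of traces over disjoint variable sets A and B
-- (disjointness is modelled by the disjoint union A ⊎ B).
join : {A B : Set} → Val A → Val B → Val (A ⊎ B)
join x y (inj₁ a) = x a
join x y (inj₂ b) = y b

_⊔_ : {A B : Set} {m : ℕ} → FinTrace A m → FinTrace B m → FinTrace (A ⊎ B) m
(π ⊔ π') i = join (π i) (π' i)

prefix : {V : Set} {m : ℕ} (n : ℕ) → n ≤ m → FinTrace V m → FinTrace V n
prefix n n≤m π i = π (inject≤ i n≤m)

data LTL (A : Set) : Set where
  tt    : LTL A
  atom  : A → LTL A
  ¬'_   : LTL A → LTL A
  _∧'_  : LTL A → LTL A → LTL A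
  X_    : LTL A → LTL A
  _U_   : LTL A → LTL A → LTL A

size : {A : Set} → LTL A → ℕ
size tt        = 1
size (atom a)  = 1
size (¬' φ)    = suc (size φ)
size (φ ∧' ψ)  = suc (size φ + size ψ)
size (X φ)     = suc (size φ)
size (φ U ψ)   = suc (size φ + size ψ)

Sat : {A : Set} → InfTrace A → ℕ → LTL A → Set
Sat w i tt       = ⊤
Sat w i (atom a) = w i a ≡ true
Sat w i (¬' φ)   = ¬ (Sat w i φ)
Sat w i (φ ∧' ψ) = (Sat w i φ) × (Sat w i ψ)
Sat w i (X φ)    = Sat w (suc i) φ
Sat w i (φ U ψ)  = ∃[ k ] (i ≤ k × (Sat w k ψ) ×
                     (∀ j → i ≤ j → j < k → Sat w j φ))

_⊨_ : {A : Set} → InfTrace A → LTL A → Set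
w ⊨ φ = Sat w 0 φ

Extends : {A : Set} {n : ℕ} → InfTrace A → FinTrace A n → Set
Extends {n = n} w σ = ∀ (i : Fin n) → w (Data.Fin.toℕ i) ≡ σ i

BadPrefix : {A : Set} {n : ℕ} → FinTrace A n → LTL A → Set
BadPrefix σ φ = ¬ (∃[ w ] (Extends w σ × (w ⊨ φ)))

_⊨ₙ_ : {A : Set} {n : ℕ} → FinTrace A n → LTL A → Set
σ ⊨ₙ φ = ¬ BadPrefix σ φ

-- Prefix distinguishability relation ρ_φ, for O_e = Fin e, O_p = Fin p.

ρ : {e p : ℕ} → LTL (Fin e ⊎ Fin p) → {m : ℕ} →
    FinTrace (Fin e) m → FinTrace (Fin e) m → Set
ρ {e} {p} φ {m} π π' =
  (∀ (πp : FinTrace (Fin p) m) → ¬ ((π ⊔ πp) ⊨ₙ φ) ⊎ ¬ ((π' ⊔ πp) ⊨ₙ φ))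
  × (∀ (n : ℕ) (n<m : n < m) → ∃[ πp' ] (
        ((prefix n (<⇒≤ n<m) π ⊔ πp') ⊨ₙ φ) ×
        ((prefix n (<⇒≤ n<m) π' ⊔ πp') ⊨ₙ φ)))

record NFA (Σ' : Set) : Set where
  field
    states    : ℕ
    initial   : Fin states → Bool
    δ         : Fin states → Σ' → Fin states → Bool
    accepting : Fin states → Bool

Accepts : {Σ' : Set} → NFA Σ' → {m : ℕ} → (Fin m → Σ') → Set
Accepts {Σ'} A {m} w =
  Σ (Fin (suc m) → Fin states) λ r → ((initial (r zero) ≡ true)
         × (∀ (i : Fin m) → δ (r (inject₁ i)) (w i) (r (suc i)) ≡ true)
         × (accepting (r (fromℕ m)) ≡ true))
  where open NFA A

module Submission where

-- The good prefixes of φ are those read by Wolper's tableau. Labels are sets of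
-- positions in the closure of φ; repeatedly discarding the labels that have no
-- successor from which their pending eventualities can be fulfilled leaves the viable
-- labels. The labels of any model survive (soundness), and every viable label starts a
-- Hintikka sequence, hence a model (completeness), so a prefix is good iff a run of
-- viable labels starting with φ reads it. Sat is not decidable, so soundness only holds
-- under double negation, which suffices because the conclusion is a Boolean.
-- Running the tableau on π ⊔ πp and π′ ⊔ πp with a common, guessed πp, and using
-- that good prefixes are prefix closed, (π , π′) ∈ ρ iff some pair of labels is
-- reachable after m − 1 letters but none after m. A deterministic automaton tracks the
-- set of reachable pairs of labels, of which there are 4 ^ size φ, and one flag; it has
-- 2 ^ (1 + 4 ^ size φ) ≤ 2 ^ 2 ^ (3 * size φ) states.

open import Defs
open import Data.Bool using (Bool; true; false; T; not; _∧_; _∨_; if_then_else_)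
open import Data.Bool.ListAction using (any; all; and; or)
open import Data.Bool.Properties using (T-∧; T-∨; T-≡; T?; not-injective)
open import Data.Empty using (⊥-elim)
open import Data.Fin using (Fin; zero; suc; toℕ; fromℕ; fromℕ<; inject₁; inject≤; _↑ˡ_; _↑ʳ_; splitAt; combine; remQuot; finToFun; funToFin)
open import Data.Fin.Properties using (2↔Bool; finToFun-funToFin; remQuot-combine; splitAt-↑ˡ; splitAt-↑ʳ; toℕ<n; toℕ-fromℕ<; toℕ-inject≤)
import Data.Fin.Properties as Fin
open import Data.List using (List; []; _∷_; allFin; length; cartesianProduct)
open import Data.List.Membership.Propositional using (_∈_; lose; find)
open import Data.List.Membership.Propositional.Properties using (∈-allFin; ∈-cartesianProduct⁺)
open import Data.List.Properties using (map-cong)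
open import Data.List.Relation.Unary.All as All using (All; []; _∷_)
open import Data.List.Relation.Unary.All.Properties using (all⁺; all⁻)
open import Data.List.Relation.Unary.Any.Properties using (any⁺; any⁻)
open import Data.Nat using (ℕ; zero; suc; _+_; _*_; _∸_; _^_; _≤_; _<_; z≤n; s≤s) renaming (_⊔_ to _⊔ℕ_)
open import Data.Nat.Properties
open import Data.Product using (Σ; ∃; ∃-syntax; _×_; _,_; proj₁; proj₂)
open import Data.Product.Function.NonDependent.Propositional using (_×-⇔_)
open import Data.Sum as Sum using (_⊎_; inj₁; inj₂)
open import Data.Sum.Function.Propositional using (_⊎-⇔_)
open import Data.Sum.Properties using (≡-dec)
open import Data.Unit using (⊤; tt)
open import Effect.Monad using (RawMonad)
open import Function using (_∘_)
open import Function.Bundles using (_⇔_; mk⇔; Equivalence; Inverse)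
open import Function.Properties.Equivalence using () renaming (sym to ⇔-sym; refl to ⇔-refl)
open import Function.Related.Propositional using (module EquationalReasoning)
open import Function.Related.TypeIsomorphisms using (¬-cong-⇔)
open import Level using (0ℓ)
open import Relation.Binary.Definitions using (DecidableEquality)
open import Relation.Binary.PropositionalEquality
  using (_≡_; refl; sym; trans; cong; cong₂; subst; _≗_; module ≡-Reasoning)
open import Relation.Nullary using (¬_; Dec; yes; no)
open import Relation.Nullary.Decidable using (⌊_⌋; toWitness; fromWitness; decidable-stable; ¬¬-excluded-middle)
open import Relation.Nullary.Negation using (¬¬-Monad; ¬¬-map)

open Equivalence using (to; from)

-- Boolean predicates on finite types

∧⁺ : ∀ {a b} → T a → T b → T (a ∧ b)
∧⁺ p q = from T-∧ (p , q)

∧⁻ : ∀ {a b} → T (a ∧ b) → T a × T b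
∧⁻ = to T-∧

∨⁺ˡ : ∀ {a b} → T a → T (a ∨ b)
∨⁺ˡ p = from T-∨ (inj₁ p)

∨⁺ʳ : ∀ {a b} → T b → T (a ∨ b)
∨⁺ʳ q = from T-∨ (inj₂ q)

∨⁻ : ∀ {a b} → T (a ∨ b) → T a ⊎ T b
∨⁻ = to T-∨

T-not : ∀ {b} → T (not b) ⇔ (¬ T b)
T-not {true}  = mk⇔ (λ ()) (λ ¬⊤ → ¬⊤ _)
T-not {false} = mk⇔ (λ _ ()) _

infix 4 _==_

_==_ : Bool → Bool → Bool
true  == b = b
false == b = not b

T-== : ∀ {a b} → T (a == b) ⇔ (T a ⇔ T b)
T-== {true}  {true}  = mk⇔ (λ _ → mk⇔ _ _) _
T-== {true}  {false} = mk⇔ (λ ()) (λ e → to e _)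
T-== {false} {true}  = mk⇔ (λ ()) (λ e → from e _)
T-== {false} {false} = mk⇔ (λ _ → mk⇔ (λ ()) (λ ())) _

bits : ∀ {k} → Fin (2 ^ k) → Fin k → Bool
bits c = Inverse.to 2↔Bool ∘ finToFun c

fromBits : ∀ {k} → (Fin k → Bool) → Fin (2 ^ k)
fromBits f = funToFin (Inverse.from 2↔Bool ∘ f)

bits-fromBits : ∀ {k} (f : Fin k → Bool) → bits (fromBits f) ≗ f
bits-fromBits f i = trans (cong (Inverse.to 2↔Bool) (finToFun-funToFin _ i)) (Inverse.strictlyInverseˡ 2↔Bool (f i))

record Finite (V : Set) : Set where
  field
    elements : List V
    complete : ∀ v → v ∈ elements

open Finite ⦃ ... ⦄

cardinality : (V : Set) ⦃ _ : Finite V ⦄ → ℕ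
cardinality V = length (elements {V})

instance
  Fin-finite : ∀ {k} → Finite (Fin k)
  Fin-finite = record { elements = allFin _ ; complete = ∈-allFin }

  ×-finite : ∀ {V W : Set} → ⦃ Finite V ⦄ → ⦃ Finite W ⦄ → Finite (V × W)
  ×-finite = record { elements = cartesianProduct elements elements
                    ; complete = λ (v , w) → ∈-cartesianProduct⁺ (complete v) (complete w) }

module _ {V : Set} ⦃ _ : Finite V ⦄ where

  ∃ᵇ ∀ᵇ : (V → Bool) → Bool
  ∃ᵇ p = any p elements
  ∀ᵇ p = all p elements

  ∃ᵇ⁺ : ∀ (p : V → Bool) v → T (p v) → T (∃ᵇ p)
  ∃ᵇ⁺ p v pv = any⁺ p (lose (complete v) pv)

  ∃ᵇ⁻ : ∀ (p : V → Bool) → T (∃ᵇ p) → ∃ λ v → T (p v)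
  ∃ᵇ⁻ p h with v , _ , pv ← find (any⁻ p elements h) = v , pv

  ∀ᵇ⁺ : ∀ (p : V → Bool) → (∀ v → T (p v)) → T (∀ᵇ p)
  ∀ᵇ⁺ p h = all⁻ p {elements} (All.tabulate λ {v} _ → h v)

  ∀ᵇ⁻ : ∀ (p : V → Bool) → T (∀ᵇ p) → ∀ v → T (p v)
  ∀ᵇ⁻ p h v = All.lookup (all⁺ p elements h) (complete v)

  ∃ᵇ-cong : ∀ {p q : V → Bool} → p ≗ q → ∃ᵇ p ≡ ∃ᵇ q
  ∃ᵇ-cong p≗q = cong or (map-cong p≗q elements)

  ∀ᵇ-cong : ∀ {p q : V → Bool} → p ≗ q → ∀ᵇ p ≡ ∀ᵇ q
  ∀ᵇ-cong p≗q = cong and (map-cong p≗q elements)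

-- Monotone chains and bounded reachability

infix 4 _⊆ᵇ_

_⊆ᵇ_ : {V : Set} → (V → Bool) → (V → Bool) → Set
P ⊆ᵇ Q = ∀ v → T (P v) → T (Q v)

count : {V : Set} → (V → Bool) → List V → ℕ
count p []       = 0
count p (x ∷ xs) = if p x then suc (count p xs) else count p xs

module _ {V : Set} {P Q : V → Bool} (Q⊆P : Q ⊆ᵇ P) where

  count-mono : ∀ xs → count Q xs ≤ count P xs
  count-mono [] = z≤n
  count-mono (x ∷ xs) with Q x in qx | P x in px
  ... | true  | true  = s≤s (count-mono xs)
  ... | true  | false = ⊥-elim (subst T px (Q⊆P x (subst T (sym qx) _)))
  ... | false | true  = m≤n⇒m≤1+n (count-mono xs)
  ... | false | false = count-mono xs

  count-mono-strict : ∀ xs → All (λ x → P x ≡ Q x) xs ⊎ count Q xs < count P xs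
  count-mono-strict [] = inj₁ []
  count-mono-strict (x ∷ xs) with Q x in qx | P x in px
  ... | true  | true  = Sum.map (trans px (sym qx) ∷_) s≤s (count-mono-strict xs)
  ... | true  | false = ⊥-elim (subst T px (Q⊆P x (subst T (sym qx) _)))
  ... | false | true  = inj₂ (s≤s (count-mono xs))
  ... | false | false = Sum.map₁ (trans px (sym qx) ∷_) (count-mono-strict xs)

count≤length : ∀ {V : Set} (p : V → Bool) xs → count p xs ≤ length xs
count≤length p []       = z≤n
count≤length p (x ∷ xs) with p x
... | true  = s≤s (count≤length p xs)
... | false = m≤n⇒m≤1+n (count≤length p xs)

module _ {V : Set} (Y : ℕ → V → Bool)
         (propagate : ∀ k → Y k ≗ Y (suc k) → Y (suc k) ≗ Y (suc (suc k))) where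

  stable-from : ∀ k → Y k ≗ Y (suc k) → ∀ d → Y k ≗ Y (d + k)
  stable-from k e zero    v = refl
  stable-from k e (suc d) v = trans (stable-from k e d v) (steady d v)
    where
    steady : ∀ d → Y (d + k) ≗ Y (suc (d + k))
    steady zero    = e
    steady (suc d) = propagate (d + k) (steady d)

  module _ ⦃ _ : Finite V ⦄ where

    decreasing-stabilises : (∀ k → Y (suc k) ⊆ᵇ Y k) → Y (cardinality V) ≗ Y (suc (cardinality V))
    decreasing-stabilises shrink with progress (cardinality V)
      where
      pointwise : ∀ {k} → All (λ v → Y k v ≡ Y (suc k) v) elements → Y k ≗ Y (suc k)
      pointwise eqs v = All.lookup eqs (complete v)
      progress : ∀ k → Y k ≗ Y (suc k) ⊎ suc k + count (Y (suc k)) elements ≤ count (Y 0) elements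
      progress zero = Sum.map₁ pointwise (count-mono-strict (shrink 0) elements)
      progress (suc k) with progress k
      ... | inj₁ e  = inj₁ (propagate k e)
      ... | inj₂ le = Sum.map pointwise (λ lt → ≤-trans (≤-reflexive (sym (+-suc (suc k) _)))
                                                         (≤-trans (+-monoʳ-≤ (suc k) lt) le))
                              (count-mono-strict (shrink (suc k)) elements)
    ... | inj₁ e  = e
    ... | inj₂ le = ⊥-elim (<-irrefl refl (≤-trans (m≤m+n _ _) (≤-trans le (count≤length (Y 0) elements))))

module _ {V : Set} ⦃ _ : Finite V ⦄ (Y : ℕ → V → Bool)
         (propagate : ∀ k → Y k ≗ Y (suc k) → Y (suc k) ≗ Y (suc (suc k))) where

  increasing-stabilises : (∀ k → Y k ⊆ᵇ Y (suc k)) → Y (cardinality V) ≗ Y (suc (cardinality V))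
  increasing-stabilises grow v = not-injective (decreasing-stabilises (λ k → not ∘ Y k) propagate′ shrink v)
    where
    propagate′ : ∀ k → (not ∘ Y k) ≗ (not ∘ Y (suc k)) → (not ∘ Y (suc k)) ≗ (not ∘ Y (suc (suc k)))
    propagate′ k e v = cong not (propagate k (λ u → not-injective (e u)) v)
    shrink : ∀ k → (not ∘ Y (suc k)) ⊆ᵇ (not ∘ Y k)
    shrink k v ¬y′ = from T-not λ y → to T-not ¬y′ (grow k v y)

module Reachability {V : Set} ⦃ _ : Finite V ⦄ (Edge : V → V → Bool) (Target : V → Bool) where

  reachWithin : ℕ → V → Bool
  reachWithin zero    v = Target v
  reachWithin (suc k) v = Target v ∨ ∃ᵇ (λ u → Edge v u ∧ reachWithin k u)

  reachable : V → Bool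
  reachable = reachWithin (cardinality V)

  reachWithin-suc : ∀ k v → T (reachWithin (suc k) v) ⇔
                    (T (Target v) ⊎ ∃ λ u → T (Edge v u) × T (reachWithin k u))
  reachWithin-suc k v = mk⇔
    (Sum.map₂ (λ s → let u , eu = ∃ᵇ⁻ (λ u → Edge v u ∧ reachWithin k u) s in u , ∧⁻ eu) ∘ ∨⁻)
    (Sum.[ ∨⁺ˡ , (λ (u , e , r) → ∨⁺ʳ (∃ᵇ⁺ (λ u → Edge v u ∧ reachWithin k u) u (∧⁺ e r))) ])

  Target⊆reachWithin : ∀ k → Target ⊆ᵇ reachWithin k
  Target⊆reachWithin zero    v t = t
  Target⊆reachWithin (suc k) v t = ∨⁺ˡ t

  path⇒reachWithin : ∀ t (f : ℕ → V) → (∀ j → j < t → T (Edge (f j) (f (suc j)))) →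
                     T (Target (f t)) → T (reachWithin t (f 0))
  path⇒reachWithin zero    f edges t = t
  path⇒reachWithin (suc k) f edges t = from (reachWithin-suc k (f 0)) (inj₂ (f 1 , edges 0 (s≤s z≤n) ,
    path⇒reachWithin k (f ∘ suc) (λ j j<k → edges (suc j) (s≤s j<k)) t))

  private
    grow : ∀ k → reachWithin k ⊆ᵇ reachWithin (suc k)
    grow zero    v t = ∨⁺ˡ t
    grow (suc k) v r = from (reachWithin-suc (suc k) v)
      (Sum.map₂ (λ (u , e , r) → u , e , grow k u r) (to (reachWithin-suc k v) r))

    grow-by : ∀ d k → reachWithin k ⊆ᵇ reachWithin (d + k)
    grow-by zero    k v r = r
    grow-by (suc d) k v r = grow (d + k) v (grow-by d k v r)

    propagate : ∀ k → reachWithin k ≗ reachWithin (suc k) → reachWithin (suc k) ≗ reachWithin (suc (suc k))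
    propagate k e v = cong (Target v ∨_) (∃ᵇ-cong (λ u → cong (Edge v u ∧_) (e u)))

  reachWithin⊆reachable : ∀ k → reachWithin k ⊆ᵇ reachable
  reachWithin⊆reachable k v r with ≤-total k (cardinality V)
  ... | inj₁ k≤B = subst (λ z → T (reachWithin z v)) (m∸n+n≡m k≤B) (grow-by (cardinality V ∸ k) k v r)
  ... | inj₂ B≤k = subst T (sym (stable-from reachWithin propagate (cardinality V) stable (k ∸ cardinality V) v))
                     (subst (λ z → T (reachWithin z v)) (sym (m∸n+n≡m B≤k)) r)
    where
    stable : reachWithin (cardinality V) ≗ reachWithin (suc (cardinality V))
    stable = increasing-stabilises reachWithin propagate grow

reachWithin-cong : ∀ {V : Set} ⦃ _ : Finite V ⦄ {E E′ : V → V → Bool} (Target : V → Bool) →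
                   (∀ u v → E u v ≡ E′ u v) →
                   ∀ k → Reachability.reachWithin E Target k ≗ Reachability.reachWithin E′ Target k
reachWithin-cong Target E≗E′ zero    v = refl
reachWithin-cong Target E≗E′ (suc k) v =
  cong (Target v ∨_) (∃ᵇ-cong (λ u → cong₂ _∧_ (E≗E′ v u) (reachWithin-cong Target E≗E′ k u)))

-- Finite choice under double negation

bounded-witnesses : ∀ {k} (Q : Fin k → ℕ → Set) → (∀ i → ∃ (Q i)) →
                    ∃ λ K → ∀ i → ∃ λ s → s ≤ K × Q i s
bounded-witnesses {zero}  Q h = 0 , λ ()
bounded-witnesses {suc k} Q h with K , bound ← bounded-witnesses (Q ∘ suc) (h ∘ suc) | s₀ , q₀ ← h zero =
  s₀ ⊔ℕ K , λ { zero    → s₀ , m≤m⊔n s₀ K , q₀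
             ; (suc i) → let s , s≤K , q = bound i in s , ≤-trans s≤K (m≤n⊔m s₀ K) , q }

module _ where
  open RawMonad (¬¬-Monad {a = 0ℓ})

  ¬¬-decide : ∀ {k} (P : Fin k → Set) → ¬ ¬ (∀ i → Dec (P i))
  ¬¬-decide {zero}  P = pure λ ()
  ¬¬-decide {suc k} P = do
    d₀ ← ¬¬-excluded-middle
    ds ← ¬¬-decide (P ∘ suc)
    pure λ { zero → d₀ ; (suc i) → ds i }

  ¬¬-choice : ∀ {X : Set} {P : ℕ → X → Set} K → (∀ j → ¬ ¬ Σ X (P j)) →
              ¬ ¬ Σ (ℕ → X) λ g → ∀ j → j ≤ K → P j (g j)
  ¬¬-choice zero h = do
    x , p ← h 0
    pure ((λ _ → x) , λ { zero z≤n → p })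
  ¬¬-choice (suc K) h = do
    x , p ← h 0
    g , q ← ¬¬-choice K (h ∘ suc)
    pure ((λ { zero → x ; (suc j) → g j }) , λ { zero _ → p ; (suc j) (s≤s j≤K) → q j j≤K })

-- The until operator

module _ {A : Set} (W : InfTrace A) (ψ χ : LTL A) where

  until-now : ∀ {t} → Sat W t χ → Sat W t (ψ U χ)
  until-now {t} sχ = t , ≤-refl , sχ , λ j t≤j j<t → ⊥-elim (≤⇒≯ t≤j j<t)

  until-later : ∀ {t} → Sat W t ψ → Sat W (suc t) (ψ U χ) → Sat W t (ψ U χ)
  until-later {t} sψ (k , t<k , sχ , before) = k , <⇒≤ t<k , sχ , before′
    where
    before′ : ∀ j → t ≤ j → j < k → Sat W j ψ
    before′ j t≤j j<k with m≤n⇒m<n∨m≡n t≤j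
    ... | inj₁ t<j  = before j t<j j<k
    ... | inj₂ refl = sψ

  until-expansion : ∀ t → Sat W t (ψ U χ) ⇔ (Sat W t χ ⊎ (Sat W t ψ × Sat W (suc t) (ψ U χ)))
  until-expansion t = mk⇔ unfold (Sum.[ until-now , (λ (sψ , sU) → until-later sψ sU) ])
    where
    unfold : Sat W t (ψ U χ) → Sat W t χ ⊎ (Sat W t ψ × Sat W (suc t) (ψ U χ))
    unfold (k , t≤k , sχ , before) with m≤n⇒m<n∨m≡n t≤k
    ... | inj₁ t<k  = inj₂ (before t ≤-refl t<k , k , t<k , sχ , λ j t<j → before j (<⇒≤ t<j))
    ... | inj₂ refl = inj₁ sχ

  until-induction : (P : ℕ → Set) → (∀ {t} → Sat W t χ → P t) →
                    (∀ {t} → Sat W t ψ → P (suc t) → P t) → ∀ t → Sat W t (ψ U χ) → P t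
  until-induction P now later t (k , t≤k , sχ , before) = go (k ∸ t) t (m∸n+n≡m t≤k) before
    where
    go : ∀ d t → d + t ≡ k → (∀ j → t ≤ j → j < k → Sat W j ψ) → P t
    go zero    t refl before = now sχ
    go (suc d) t eq   before = later (before t ≤-refl (subst (t <_) eq (s≤s (m≤n+m t d))))
                                     (go d (suc t) (trans (+-suc d t) eq) (λ j t<j → before j (<⇒≤ t<j)))

-- Subformula closure

Children : {A : Set} → LTL A → LTL A → LTL A → Set
Children (¬' ψ)   l r = l ≡ ψ
Children (ψ ∧' χ) l r = l ≡ ψ × r ≡ χ
Children (X ψ)    l r = l ≡ ψ
Children (ψ U χ)  l r = l ≡ ψ × r ≡ χ
Children _        l r = ⊤

-- Occurrences of subformulas of φ, numbered by Fin n; left and right point to the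
-- immediate subformulas and are arbitrary at leaves.
record Closure {A : Set} (φ : LTL A) (n : ℕ) : Set where
  field
    formula      : Fin n → LTL A
    left right   : Fin n → Fin n
    children     : ∀ i → Children (formula i) (formula (left i)) (formula (right i))
    root         : Fin n
    formula-root : formula root ≡ φ

module _ {A : Set} where

  private
    leaf : (φ : LTL A) → (∀ l r → Children φ l r) → Closure φ 1
    leaf φ ch = record { formula = λ _ → φ ; left = λ i → i ; right = λ i → i
                       ; children = λ _ → ch φ φ ; root = zero ; formula-root = refl }

    unary : (op : LTL A → LTL A) (ψ : LTL A) → (∀ l r → l ≡ ψ → Children (op ψ) l r) →
            ∀ {n} → Closure ψ n → Closure (op ψ) (suc n)
    unary op ψ ch C = record { formula = f ; left = l ; right = r ; children = c ; root = zero ; formula-root = refl }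
      where
      open Closure C
      f : Fin _ → LTL A
      f zero    = op ψ
      f (suc i) = formula i
      l r : Fin _ → Fin _
      l zero    = suc root
      l (suc i) = suc (left i)
      r zero    = suc root
      r (suc i) = suc (right i)
      c : ∀ i → Children (f i) (f (l i)) (f (r i))
      c zero    = ch _ _ formula-root
      c (suc i) = children i

    binary : (op : LTL A → LTL A → LTL A) (ψ χ : LTL A) →
             (∀ l r → l ≡ ψ → r ≡ χ → Children (op ψ χ) l r) →
             ∀ {n₁ n₂} → Closure ψ n₁ → Closure χ n₂ → Closure (op ψ χ) (suc (n₁ + n₂))
    binary op ψ χ ch {n₁} {n₂} C₁ C₂ =
      record { formula = f ; left = l ; right = r ; children = c ; root = zero ; formula-root = refl }
      where
      module C₁ = Closure C₁
      module C₂ = Closure C₂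
      inl : Fin n₁ → Fin (suc (n₁ + n₂))
      inl j = suc (j ↑ˡ n₂)
      inr : Fin n₂ → Fin (suc (n₁ + n₂))
      inr j = suc (n₁ ↑ʳ j)
      f : Fin (suc (n₁ + n₂)) → LTL A
      f zero    = op ψ χ
      f (suc i) = Sum.[ C₁.formula , C₂.formula ] (splitAt n₁ i)
      l r : Fin (suc (n₁ + n₂)) → Fin (suc (n₁ + n₂))
      l zero    = inl C₁.root
      l (suc i) = Sum.[ inl ∘ C₁.left , inr ∘ C₂.left ] (splitAt n₁ i)
      r zero    = inr C₂.root
      r (suc i) = Sum.[ inl ∘ C₁.right , inr ∘ C₂.right ] (splitAt n₁ i)
      f-inl : ∀ j → f (inl j) ≡ C₁.formula j
      f-inl j rewrite splitAt-↑ˡ n₁ j n₂ = refl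
      f-inr : ∀ j → f (inr j) ≡ C₂.formula j
      f-inr j rewrite splitAt-↑ʳ n₁ n₂ j = refl
      c-split : ∀ s → Children (Sum.[ C₁.formula , C₂.formula ] s)
                               (f (Sum.[ inl ∘ C₁.left , inr ∘ C₂.left ] s))
                               (f (Sum.[ inl ∘ C₁.right , inr ∘ C₂.right ] s))
      c-split (inj₁ j) rewrite f-inl (C₁.left j) | f-inl (C₁.right j) = C₁.children j
      c-split (inj₂ j) rewrite f-inr (C₂.left j) | f-inr (C₂.right j) = C₂.children j
      c : ∀ i → Children (f i) (f (l i)) (f (r i))
      c zero    = ch _ _ (trans (f-inl C₁.root) C₁.formula-root) (trans (f-inr C₂.root) C₂.formula-root)
      c (suc i) = c-split (splitAt n₁ i)

  closure : (φ : LTL A) → Closure φ (size φ)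
  closure tt       = leaf tt (λ _ _ → tt)
  closure (atom a) = leaf (atom a) (λ _ _ → tt)
  closure (¬' ψ)   = unary ¬'_ ψ (λ _ _ eq → eq) (closure ψ)
  closure (X ψ)    = unary X_ ψ (λ _ _ eq → eq) (closure ψ)
  closure (ψ ∧' χ) = binary _∧'_ ψ χ (λ _ _ eq eq′ → eq , eq′) (closure ψ) (closure χ)
  closure (ψ U χ)  = binary _U_ ψ χ (λ _ _ eq eq′ → eq , eq′) (closure ψ) (closure χ)

module Tableau {A : Set} (_≟ᴬ_ : DecidableEquality A) {φ : LTL A} {n : ℕ} (C : Closure φ n) where

  open Closure C public

  -- A label is a set of positions of the closure, coded by its characteristic bit string.
  Label : Set
  Label = Fin (2 ^ n)

  infix 7 _∋_

  _∋_ : Label → Fin n → Bool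
  _∋_ = bits

  isAtom : LTL A → A → Bool
  isAtom (atom b) a = ⌊ b ≟ᴬ a ⌋
  isAtom _        a = false

  isUntil : LTL A → Bool
  isUntil (_ U _) = true
  isUntil _       = false

  localAt : LTL A → Label → Fin n → Bool
  localAt tt       L i = L ∋ i
  localAt (¬' _)   L i = (L ∋ i) == not (L ∋ left i)
  localAt (_ ∧' _) L i = (L ∋ i) == (L ∋ left i ∧ L ∋ right i)
  localAt _        L i = true

  stepAt : LTL A → Label → Label → Fin n → Bool
  stepAt (X _)   L L′ i = (L ∋ i) == (L′ ∋ left i)
  stepAt (_ U _) L L′ i = (L ∋ i) == (L ∋ right i ∨ (L ∋ left i ∧ L′ ∋ i))
  stepAt _       L L′ i = true

  matchAt : LTL A → Label → Val A → Fin n → Bool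
  matchAt (atom a) L v i = (L ∋ i) == v a
  matchAt _        L v i = true

  Local : Label → Bool
  Local L = ∀ᵇ λ i → localAt (formula i) L i

  Step : Label → Label → Bool
  Step L L′ = ∀ᵇ λ i → stepAt (formula i) L L′ i

  Match : Label → Val A → Bool
  Match L v = ∀ᵇ λ i → matchAt (formula i) L v i

  valuation : Label → Val A
  valuation L a = ∃ᵇ λ i → isAtom (formula i) a ∧ L ∋ i

  Consistent : Label → Bool
  Consistent L = Local L ∧ Match L (valuation L)

  matchAt-cong : ∀ ψ {L v v′ i} → v ≗ v′ → matchAt ψ L v i ≡ matchAt ψ L v′ i
  matchAt-cong (atom a) {L} {i = i} v≗v′ = cong (L ∋ i ==_) (v≗v′ a)
  matchAt-cong tt       _    = refl
  matchAt-cong (¬' _)   _    = refl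
  matchAt-cong (_ ∧' _) _    = refl
  matchAt-cong (X _)    _    = refl
  matchAt-cong (_ U _)  _    = refl

  Match-cong : ∀ {L v v′} → v ≗ v′ → Match L v ≡ Match L v′
  Match-cong v≗v′ = ∀ᵇ-cong λ i → matchAt-cong (formula i) v≗v′

  module _ {i : Fin n} {ψ : LTL A} (eq : formula i ≡ ψ) where

    children-at : Children ψ (formula (left i)) (formula (right i))
    children-at = subst (λ ψ → Children ψ (formula (left i)) (formula (right i))) eq (children i)

    local-at : ∀ {L} → T (Local L) → T (localAt ψ L i)
    local-at {L} h = subst (λ ψ → T (localAt ψ L i)) eq (∀ᵇ⁻ (λ i → localAt (formula i) L i) h i)

    step-at : ∀ {L L′} → T (Step L L′) → T (stepAt ψ L L′ i)
    step-at {L} {L′} h = subst (λ ψ → T (stepAt ψ L L′ i)) eq (∀ᵇ⁻ (λ i → stepAt (formula i) L L′ i) h i)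

    match-at : ∀ {L v} → T (Match L v) → T (matchAt ψ L v i)
    match-at {L} {v} h = subst (λ ψ → T (matchAt ψ L v i)) eq (∀ᵇ⁻ (λ i → matchAt (formula i) L v i) h i)

  isUntil⁻ : ∀ ψ → T (isUntil ψ) → ∃ λ ψ₁ → ∃ λ ψ₂ → ψ ≡ ψ₁ U ψ₂
  isUntil⁻ (ψ₁ U ψ₂) _ = ψ₁ , ψ₂ , refl

  until-persists : ∀ {M M′ i ψ χ} → T (Step M M′) → formula i ≡ ψ U χ →
                   T (M ∋ i) → ¬ T (M ∋ right i) → T (M′ ∋ i)
  until-persists st eq p r∉ with ∨⁻ (to (to T-== (step-at eq st)) p)
  ... | inj₁ r  = ⊥-elim (r∉ r)
  ... | inj₂ lp = proj₂ (∧⁻ lp)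

  isAtom⁻ : ∀ ψ a → T (isAtom ψ a) → ψ ≡ atom a
  isAtom⁻ (atom b) a p = cong atom (toWitness {a? = b ≟ᴬ a} p)

  match⇒match-valuation : ∀ {L v} → T (Match L v) → T (Match L (valuation L))
  match⇒match-valuation {L} {v} m = ∀ᵇ⁺ _ λ i → atoms-agree i (formula i) refl
    where
    atoms-agree : ∀ i ψ → formula i ≡ ψ → T (matchAt ψ L (valuation L) i)
    atoms-agree i (atom a) eq =
      from T-== (mk⇔ (λ p → ∃ᵇ⁺ (λ j → isAtom (formula j) a ∧ L ∋ j) i (∧⁺ isAtom-i p)) agree)
      where
      isAtom-i : T (isAtom (formula i) a)
      isAtom-i = subst (λ ψ → T (isAtom ψ a)) (sym eq) (fromWitness {a? = a ≟ᴬ a} refl)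
      agree : T (valuation L a) → T (L ∋ i)
      agree q with j , r ← ∃ᵇ⁻ _ q with isAtom-j , p ← ∧⁻ r =
        from (to T-== (match-at eq m)) (to (to T-== (match-at (isAtom⁻ (formula j) a isAtom-j) m)) p)
    atoms-agree i tt       _ = _
    atoms-agree i (¬' _)   _ = _
    atoms-agree i (_ ∧' _) _ = _
    atoms-agree i (X _)    _ = _
    atoms-agree i (_ U _)  _ = _

  record Hintikka (N : ℕ → Label) (W : InfTrace A) : Set where
    field
      local : ∀ t → T (Local (N t))
      step  : ∀ t → T (Step (N t) (N (suc t)))
      match : ∀ t → T (Match (N t) (W t))
      fair  : ∀ t i {ψ χ} → formula i ≡ ψ U χ → T (N t ∋ i) → ∃ λ s → t ≤ s × T (N s ∋ right i)

  module _ {N : ℕ → Label} {W : InfTrace A} (H : Hintikka N W) where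

    open Hintikka H
    open EquationalReasoning

    hintikka-truth : ∀ ψ i → formula i ≡ ψ → ∀ t → T (N t ∋ i) ⇔ Sat W t ψ
    hintikka-truth tt i eq t = mk⇔ _ (λ _ → local-at eq (local t))
    hintikka-truth (atom a) i eq t = begin
      T (N t ∋ i)  ∼⟨ to T-== (match-at eq (match t)) ⟩
      T (W t a)    ∼⟨ T-≡ ⟩
      W t a ≡ true ∎
    hintikka-truth (¬' ψ) i eq t = begin
      T (N t ∋ i)              ∼⟨ to T-== (local-at eq (local t)) ⟩
      T (not (N t ∋ left i))   ∼⟨ T-not ⟩
      (¬ T (N t ∋ left i))     ∼⟨ ¬-cong-⇔ (hintikka-truth ψ (left i) (children-at eq) t) ⟩
      (¬ Sat W t ψ)            ∎
    hintikka-truth (ψ ∧' χ) i eq t = begin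
      T (N t ∋ i)                          ∼⟨ to T-== (local-at eq (local t)) ⟩
      T (N t ∋ left i ∧ N t ∋ right i)     ∼⟨ T-∧ ⟩
      (T (N t ∋ left i) × T (N t ∋ right i)) ∼⟨ hintikka-truth ψ (left i) (proj₁ (children-at eq)) t
                                                ×-⇔ hintikka-truth χ (right i) (proj₂ (children-at eq)) t ⟩
      (Sat W t ψ × Sat W t χ)              ∎
    hintikka-truth (X ψ) i eq t = begin
      T (N t ∋ i)              ∼⟨ to T-== (step-at eq (step t)) ⟩
      T (N (suc t) ∋ left i)   ∼⟨ hintikka-truth ψ (left i) (children-at eq) (suc t) ⟩
      Sat W (suc t) ψ          ∎
    hintikka-truth (ψ U χ) i eq t = mk⇔ (fulfil t) (until-induction W ψ χ (λ t → T (N t ∋ i)) now later t)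
      where
      truthψ : ∀ t → T (N t ∋ left i) ⇔ Sat W t ψ
      truthψ = hintikka-truth ψ (left i) (proj₁ (children-at eq))
      truthχ : ∀ t → T (N t ∋ right i) ⇔ Sat W t χ
      truthχ = hintikka-truth χ (right i) (proj₂ (children-at eq))
      unfold : ∀ t → T (N t ∋ i) ⇔ T (N t ∋ right i ∨ (N t ∋ left i ∧ N (suc t) ∋ i))
      unfold t = to T-== (step-at eq (step t))
      now : ∀ {t} → Sat W t χ → T (N t ∋ i)
      now {t} sχ = from (unfold t) (∨⁺ˡ (from (truthχ t) sχ))
      later : ∀ {t} → Sat W t ψ → T (N (suc t) ∋ i) → T (N t ∋ i)
      later {t} sψ next = from (unfold t) (∨⁺ʳ (∧⁺ (from (truthψ t) sψ) next))
      chase : ∀ d t → T (N t ∋ i) → T (N (d + t) ∋ right i) → Sat W t (ψ U χ)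
      chase zero    t _ r = until-now W ψ χ (to (truthχ t) r)
      chase (suc d) t p r with ∨⁻ (to (unfold t) p)
      ... | inj₁ r′ = until-now W ψ χ (to (truthχ t) r′)
      ... | inj₂ lp with l , next ← ∧⁻ lp =
        until-later W ψ χ (to (truthψ t) l)
                    (chase d (suc t) next (subst (λ s → T (N s ∋ right i)) (sym (+-suc d t)) r))
      fulfil : ∀ t → T (N t ∋ i) → Sat W t (ψ U χ)
      fulfil t p with s , t≤s , r ← fair t i eq p =
        chase (s ∸ t) t p (subst (λ s → T (N s ∋ right i)) (sym (m∸n+n≡m t≤s)) r)

module Elimination {A : Set} (_≟ᴬ_ : DecidableEquality A) {φ : LTL A} {n : ℕ} (C : Closure φ n) where

  open Tableau _≟ᴬ_ C public

  -- A node of the chase for eventualities: the current label and the eventualities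
  -- not yet fulfilled.
  Node : Set
  Node = Label × Label

  pendingAfter : Label → Label → Label
  pendingAfter D M = fromBits λ i → D ∋ i ∧ not (M ∋ right i)

  eventualities : Label → Label
  eventualities L = fromBits λ i → (isUntil (formula i) ∧ L ∋ i) ∧ not (L ∋ right i)

  Settled : Node → Bool
  Settled (_ , D) = ∀ᵇ λ i → not (D ∋ i)

  Edge : (Label → Bool) → Node → Node → Bool
  Edge S (M , D) (M′ , D′) = S M′ ∧ Step M M′ ∧ ⌊ D′ Fin.≟ pendingAfter D M′ ⌋

  module Chase (S : Label → Bool) = Reachability (Edge S) Settled

  startChase : Label → Label → Node
  startChase L M′ = M′ , pendingAfter (eventualities L) M′

  eliminate : (Label → Bool) → Label → Bool
  eliminate S L = S L ∧ ∃ᵇ λ M′ → S M′ ∧ Step L M′ ∧ Chase.reachable S (startChase L M′)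

  eliminate-cong : ∀ {S S′} → S ≗ S′ → eliminate S ≗ eliminate S′
  eliminate-cong {S} {S′} S≗S′ L = cong₂ _∧_ (S≗S′ L) (∃ᵇ-cong λ M′ → cong₂ _∧_ (S≗S′ M′)
    (cong (Step L M′ ∧_) (reachWithin-cong Settled same-edges (cardinality Node) (startChase L M′))))
    where
    same-edges : ∀ u v → Edge S u v ≡ Edge S′ u v
    same-edges (M , D) (M₂ , D₂) = cong (_∧ _) (S≗S′ M₂)

  surviving : ℕ → Label → Bool
  surviving zero    = Consistent
  surviving (suc k) = eliminate (surviving k)

  viable : Label → Bool
  viable = surviving (cardinality Label)

  viable-fixed : viable ≗ eliminate viable
  viable-fixed = decreasing-stabilises surviving (λ _ → eliminate-cong) (λ k L s → proj₁ (∧⁻ s))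

  surviving⊆Consistent : ∀ k → surviving k ⊆ᵇ Consistent
  surviving⊆Consistent zero    L c = c
  surviving⊆Consistent (suc k) L s = surviving⊆Consistent k L (proj₁ (∧⁻ s))

  viable⇒local : ∀ {L} → T (viable L) → T (Local L)
  viable⇒local v = proj₁ (∧⁻ (surviving⊆Consistent (cardinality Label) _ v))

  viable⇒match : ∀ {L} → T (viable L) → T (Match L (valuation L))
  viable⇒match v = proj₂ (∧⁻ (surviving⊆Consistent (cardinality Label) _ v))

  eventualities⁻ : ∀ L i → T (eventualities L ∋ i) →
                   ∃ λ ψ → ∃ λ χ → formula i ≡ ψ U χ × T (L ∋ i) × ¬ T (L ∋ right i)
  eventualities⁻ L i e with u∈ , r∉ ← ∧⁻ (subst T (bits-fromBits _ i) e) with u , i∈ ← ∧⁻ u∈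
                       with ψ , χ , eq ← isUntil⁻ (formula i) u = ψ , χ , eq , i∈ , to T-not r∉

  eventualities⁺ : ∀ {L i ψ χ} → formula i ≡ ψ U χ → T (L ∋ i) → ¬ T (L ∋ right i) →
                   T (eventualities L ∋ i)
  eventualities⁺ {i = i} eq i∈ r∉ =
    subst T (sym (bits-fromBits _ i)) (∧⁺ (∧⁺ (subst (T ∘ isUntil) (sym eq) _) i∈) (from T-not r∉))

  pendingAfter⁺ : ∀ {D M i} → T (D ∋ i) → ¬ T (M ∋ right i) → T (pendingAfter D M ∋ i)
  pendingAfter⁺ {i = i} d r∉ = subst T (sym (bits-fromBits _ i)) (∧⁺ d (from T-not r∉))

  pendingAfter⁻ : ∀ D M i → T (pendingAfter D M ∋ i) → T (D ∋ i) × ¬ T (M ∋ right i)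
  pendingAfter⁻ D M i p with d , r ← ∧⁻ (subst T (bits-fromBits _ i) p) = d , to T-not r

  pendingAlong : Label → (ℕ → Label) → ℕ → Label
  pendingAlong D h zero    = pendingAfter D (h 0)
  pendingAlong D h (suc j) = pendingAfter (pendingAlong D h j) (h (suc j))

  pendingAlong⁻ : ∀ D h j i → T (pendingAlong D h j ∋ i) →
                  T (D ∋ i) × (∀ s → s ≤ j → ¬ T (h s ∋ right i))
  pendingAlong⁻ D h zero i p with d , r ← pendingAfter⁻ D (h 0) i p = d , λ { zero z≤n → r }
  pendingAlong⁻ D h (suc j) i p with d , r ← pendingAfter⁻ (pendingAlong D h j) (h (suc j)) i p
                                with d₀ , before ← pendingAlong⁻ D h j i d = d₀ , unfulfilled
    where
    unfulfilled : ∀ s → s ≤ suc j → ¬ T (h s ∋ right i)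
    unfulfilled s s≤j+1 with m≤n⇒m<n∨m≡n s≤j+1
    ... | inj₁ s<j+1 = before s (≤-pred s<j+1)
    ... | inj₂ refl  = r

module Soundness {A : Set} (_≟ᴬ_ : DecidableEquality A) {φ : LTL A} {n : ℕ} (C : Closure φ n) (W : InfTrace A) where

  open Elimination _≟ᴬ_ C
  open EquationalReasoning

  TrueAt : ℕ → Label → Set
  TrueAt t L = ∀ i → T (L ∋ i) ⇔ Sat W t (formula i)

  true-at : ∀ {t L i ψ} → TrueAt t L → formula i ≡ ψ → T (L ∋ i) ⇔ Sat W t ψ
  true-at TL refl = TL _

  true-label : ∀ t → ¬ ¬ Σ Label (TrueAt t)
  true-label t = ¬¬-map decided (¬¬-decide (λ i → Sat W t (formula i)))
    where
    decided : (∀ i → Dec (Sat W t (formula i))) → Σ Label (TrueAt t)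
    decided d = fromBits (⌊_⌋ ∘ d) , λ i →
      subst (λ b → T b ⇔ _) (sym (bits-fromBits _ i)) (mk⇔ toWitness fromWitness)

  module _ {t L} (TL : TrueAt t L) where

    true-localAt : ∀ i ψ → formula i ≡ ψ → T (localAt ψ L i)
    true-localAt i tt       eq = from (true-at TL eq) _
    true-localAt i (¬' ψ)   eq = from T-== (begin
      T (L ∋ i)               ∼⟨ true-at TL eq ⟩
      (¬ Sat W t ψ)           ∼⟨ ¬-cong-⇔ (⇔-sym (true-at TL (children-at eq))) ⟩
      (¬ T (L ∋ left i))      ∼⟨ ⇔-sym T-not ⟩
      T (not (L ∋ left i))    ∎)
    true-localAt i (ψ ∧' χ) eq = from T-== (begin
      T (L ∋ i)                             ∼⟨ true-at TL eq ⟩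
      (Sat W t ψ × Sat W t χ)               ∼⟨ ⇔-sym (true-at TL (proj₁ (children-at eq))
                                                     ×-⇔ true-at TL (proj₂ (children-at eq))) ⟩
      (T (L ∋ left i) × T (L ∋ right i))    ∼⟨ ⇔-sym T-∧ ⟩
      T (L ∋ left i ∧ L ∋ right i)          ∎)
    true-localAt i (atom _) _ = _
    true-localAt i (X _)    _ = _
    true-localAt i (_ U _)  _ = _

    true-matchAt : ∀ i ψ → formula i ≡ ψ → T (matchAt ψ L (W t) i)
    true-matchAt i (atom a) eq = from T-== (begin
      T (L ∋ i)      ∼⟨ true-at TL eq ⟩
      (W t a ≡ true) ∼⟨ ⇔-sym T-≡ ⟩
      T (W t a)      ∎)
    true-matchAt i tt       _ = _
    true-matchAt i (¬' _)   _ = _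
    true-matchAt i (_ ∧' _) _ = _
    true-matchAt i (X _)    _ = _
    true-matchAt i (_ U _)  _ = _

    true-match : T (Match L (W t))
    true-match = ∀ᵇ⁺ _ λ i → true-matchAt i (formula i) refl

    true-consistent : T (Consistent L)
    true-consistent = ∧⁺ (∀ᵇ⁺ _ λ i → true-localAt i (formula i) refl) (match⇒match-valuation true-match)

    module _ {L′} (TL′ : TrueAt (suc t) L′) where

      true-stepAt : ∀ i ψ → formula i ≡ ψ → T (stepAt ψ L L′ i)
      true-stepAt i (X ψ) eq = from T-== (begin
        T (L ∋ i)          ∼⟨ true-at TL eq ⟩
        Sat W (suc t) ψ    ∼⟨ ⇔-sym (true-at TL′ (children-at eq)) ⟩
        T (L′ ∋ left i)    ∎)
      true-stepAt i (ψ U χ) eq = from T-== (begin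
        T (L ∋ i)                                                 ∼⟨ true-at TL eq ⟩
        Sat W t (ψ U χ)                                           ∼⟨ until-expansion W ψ χ t ⟩
        (Sat W t χ ⊎ (Sat W t ψ × Sat W (suc t) (ψ U χ)))
          ∼⟨ ⇔-sym (true-at TL (proj₂ (children-at eq))
                    ⊎-⇔ (true-at TL (proj₁ (children-at eq)) ×-⇔ true-at TL′ eq)) ⟩
        (T (L ∋ right i) ⊎ (T (L ∋ left i) × T (L′ ∋ i)))         ∼⟨ ⇔-sym (⇔-refl ⊎-⇔ T-∧) ⟩
        (T (L ∋ right i) ⊎ T (L ∋ left i ∧ L′ ∋ i))               ∼⟨ ⇔-sym T-∨ ⟩
        T (L ∋ right i ∨ (L ∋ left i ∧ L′ ∋ i))                   ∎)
      true-stepAt i tt       _ = _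
      true-stepAt i (atom _) _ = _
      true-stepAt i (¬' _)   _ = _
      true-stepAt i (_ ∧' _) _ = _

      true-step : T (Step L L′)
      true-step = ∀ᵇ⁺ _ λ i → true-stepAt i (formula i) refl

  eventuality-fulfilled : ∀ {t L} → TrueAt t L → ∀ i → T (eventualities L ∋ i) →
                          ∃ λ s → t < s × Sat W s (formula (right i))
  eventuality-fulfilled {t} {L} TL i e with ψ , χ , eq , i∈ , r∉ ← eventualities⁻ L i e
    with to (until-expansion W ψ χ t) (to (true-at TL eq) i∈)
  ... | inj₁ sχ = ⊥-elim (r∉ (from (true-at TL (proj₂ (children-at eq))) sχ))
  ... | inj₂ (_ , s , t<s , sχ , _) = s , t<s , subst (Sat W s) (sym (proj₂ (children-at eq))) sχ

  module _ {S : Label → Bool} (true⇒S : ∀ {t L} → TrueAt t L → T (S L)) where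

    -- The successor is the next true label, and the chase follows the true labels
    -- until every eventuality of L is fulfilled.
    true-successor : ∀ {t L} → TrueAt t L →
      ¬ ¬ T (∃ᵇ λ M′ → S M′ ∧ Step L M′ ∧ Chase.reachable S (startChase L M′))
    true-successor {t} {L} TL = ¬¬-map successor (¬¬-choice (K + suc t) true-label)
      where
      FulfilledAt : Fin n → ℕ → Set
      FulfilledAt i s = T (eventualities L ∋ i) → t < s × Sat W s (formula (right i))

      fulfilment : ∀ i → ∃ (FulfilledAt i)
      fulfilment i with T? (eventualities L ∋ i)
      ... | no ¬e = 0 , λ e → ⊥-elim (¬e e)
      ... | yes e with s , fulfilled ← eventuality-fulfilled TL i e = s , λ _ → fulfilled

      K : ℕ
      K = proj₁ (bounded-witnesses FulfilledAt fulfilment)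

      bound : ∀ i → ∃ λ s → s ≤ K × FulfilledAt i s
      bound = proj₂ (bounded-witnesses FulfilledAt fulfilment)

      successor : (Σ (ℕ → Label) λ g → ∀ j → j ≤ K + suc t → TrueAt j (g j)) →
                  T (∃ᵇ λ M′ → S M′ ∧ Step L M′ ∧ Chase.reachable S (startChase L M′))
      successor (g , true-g) = ∃ᵇ⁺ _ (h 0) (∧⁺ (true⇒S (true-h 0 z≤n)) (∧⁺ (true-step TL (true-h 0 z≤n))
        (Chase.reachWithin⊆reachable S K (f 0) (Chase.path⇒reachWithin S K f edges settled))))
        where
        h : ℕ → Label
        h j = g (j + suc t)
        true-h : ∀ j → j ≤ K → TrueAt (j + suc t) (h j)
        true-h j j≤K = true-g (j + suc t) (+-monoˡ-≤ (suc t) j≤K)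
        f : ℕ → Node
        f j = h j , pendingAlong (eventualities L) h j
        edges : ∀ j → j < K → T (Edge S (f j) (f (suc j)))
        edges j j<K = ∧⁺ (true⇒S (true-h (suc j) j<K))
                         (∧⁺ (true-step (true-h j (<⇒≤ j<K)) (true-h (suc j) j<K)) (fromWitness refl))
        settled : T (Settled (f K))
        settled = ∀ᵇ⁺ _ λ i → from T-not λ p →
          let e , unfulfilled = pendingAlong⁻ _ h K i p
              s , s≤K , q = bound i
              t<s , sat = q e
          in unfulfilled (s ∸ suc t) (≤-trans (m∸n≤m s (suc t)) s≤K)
               (subst (λ z → T (g z ∋ right i)) (sym (m∸n+n≡m t<s))
                      (from (true-g s (≤-trans s≤K (m≤m+n K (suc t))) (right i)) sat))

  true-survives : ∀ k {t L} → TrueAt t L → T (surviving k L)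
  true-survives zero    TL = true-consistent TL
  true-survives (suc k) TL = ∧⁺ (true-survives k TL) (decidable-stable (T? _) (true-successor (true-survives k) TL))

module Completeness {A : Set} (_≟ᴬ_ : DecidableEquality A) {φ : LTL A} {n : ℕ} (C : Closure φ n) where

  open Elimination _≟ᴬ_ C
  open Chase viable

  -- A state of the model construction: the current label, the eventualities still
  -- being chased, and a bound on the number of steps needed to fulfil them.
  record State : Set where
    constructor state
    field
      label        : Label
      pending      : Label
      fuel         : ℕ
      label-viable : T (viable label)
      fulfillable  : T (reachWithin fuel (label , pending))

  open State

  node : State → Node
  node s = label s , pending s

  Succeeds : State → State → Set
  Succeeds s s′ = T (Step (label s) (label s′)) ×
    (  (T (Settled (node s)) × pending s′ ≡ pendingAfter (eventualities (label s)) (label s′))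
     ⊎ (pending s′ ≡ pendingAfter (pending s) (label s′) × fuel s ≡ suc (fuel s′)))

  private
    restart : (s : State) → T (Settled (node s)) → Σ State (Succeeds s)
    restart s settled
      with M′ , found ← ∃ᵇ⁻ _ (proj₂ (∧⁻ (subst T (viable-fixed (label s)) (label-viable s))))
      with v , rest ← ∧⁻ found
      with st , r ← ∧⁻ rest =
      state M′ (pendingAfter (eventualities (label s)) M′) (cardinality Node) v r , st , inj₁ (settled , refl)

    continue : (s : State) → ¬ T (Settled (node s)) → Σ State (Succeeds s)
    continue (state M D zero    v r) unsettled = ⊥-elim (unsettled r)
    continue (state M D (suc k) v r) unsettled with to (reachWithin-suc k (M , D)) r
    ... | inj₁ settled = ⊥-elim (unsettled settled)
    ... | inj₂ ((M′ , D′) , e , r′) with v′ , rest ← ∧⁻ e with st , same ← ∧⁻ rest =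
      state M′ D′ k v′ r′ , st , inj₂ (toWitness same , refl)

  successor : (s : State) → Σ State (Succeeds s)
  successor s with T? (Settled (node s))
  ... | yes settled  = restart s settled
  ... | no unsettled = continue s unsettled

  module Run (s₀ : State) where

    run : ℕ → State
    run zero    = s₀
    run (suc t) = proj₁ (successor (run t))

    run-succeeds : ∀ t → Succeeds (run t) (run (suc t))
    run-succeeds t = proj₂ (successor (run t))

    labels : ℕ → Label
    labels = label ∘ run

    pending-fulfilled : ∀ k t i → fuel (run t) ≡ k → T (pending (run t) ∋ i) →
                        ∃ λ s → t < s × T (labels s ∋ right i)
    pending-fulfilled k t i fuel≡k p with run-succeeds t
    ... | _ , inj₁ (settled , _) = ⊥-elim (to T-not (∀ᵇ⁻ _ settled i) p)
    ... | _ , inj₂ (eq , fuel-eq) with T? (labels (suc t) ∋ right i) | k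
    ...   | yes r  | _      = suc t , ≤-refl , r
    ...   | no _   | zero   = ⊥-elim (1+n≢0 (trans (sym fuel-eq) fuel≡k))
    ...   | no r∉  | suc k′
      with s , t<s , r ← pending-fulfilled k′ (suc t) i (suc-injective (trans (sym fuel-eq) fuel≡k))
                                           (subst (λ D → T (D ∋ i)) (sym eq) (pendingAfter⁺ p r∉)) =
      s , <⇒≤ t<s , r

    until-fulfilled : ∀ k t i {ψ χ} → fuel (run t) ≡ k → formula i ≡ ψ U χ → T (labels t ∋ i) →
                      ∃ λ s → t ≤ s × T (labels s ∋ right i)
    until-fulfilled k t i fuel≡k eq p with T? (labels t ∋ right i)
    ... | yes r  = t , ≤-refl , r
    ... | no r∉ with run-succeeds t | k
    ...   | st , inj₁ (_ , pending≡) | _ with T? (labels (suc t) ∋ right i)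
    ...     | yes r′ = suc t , n≤1+n t , r′
    ...     | no r′∉
      with s , t<s , r ← pending-fulfilled (fuel (run (suc t))) (suc t) i refl
                           (subst (λ D → T (D ∋ i)) (sym pending≡) (pendingAfter⁺ (eventualities⁺ eq p r∉) r′∉)) =
      s , ≤-trans (n≤1+n t) (<⇒≤ t<s) , r
    until-fulfilled k t i fuel≡k eq p | no r∉ | _ , inj₂ (_ , fuel-eq) | zero =
      ⊥-elim (1+n≢0 (trans (sym fuel-eq) fuel≡k))
    until-fulfilled k t i fuel≡k eq p | no r∉ | st , inj₂ (_ , fuel-eq) | suc k′
      with s , t+1≤s , r ← until-fulfilled k′ (suc t) i (suc-injective (trans (sym fuel-eq) fuel≡k)) eq
                                           (until-persists st eq p r∉) =
      s , ≤-trans (n≤1+n t) t+1≤s , r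

    hintikka : Hintikka labels (valuation ∘ labels)
    hintikka = record
      { local = λ t → viable⇒local (label-viable (run t))
      ; step  = λ t → proj₁ (run-succeeds t)
      ; match = λ t → viable⇒match (label-viable (run t))
      ; fair  = λ t i eq p → until-fulfilled (fuel (run t)) t i refl eq p
      }

  viable⇒hintikka : ∀ L → T (viable L) → Σ (ℕ → Label) λ N → N 0 ≡ L × Hintikka N (valuation ∘ N)
  viable⇒hintikka L v = Run.labels s₀ , refl , Run.hintikka s₀
    where
    none : Label
    none = fromBits {n} λ _ → false
    nothing-pending : T (Settled (L , none))
    nothing-pending = ∀ᵇ⁺ (λ i → not (none ∋ i)) λ i → subst (T ∘ not) (sym (bits-fromBits _ i)) _
    s₀ : State
    s₀ = state L none (cardinality Node) v (Target⊆reachWithin (cardinality Node) _ nothing-pending)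

_∷ˢ_ : {X : Set} → X → (ℕ → X) → ℕ → X
(x ∷ˢ f) zero    = x
(x ∷ˢ f) (suc t) = f t

module GoodPrefixes {A : Set} (_≟ᴬ_ : DecidableEquality A) {φ : LTL A} {n : ℕ} (C : Closure φ n) where

  open Elimination _≟ᴬ_ C public
  open Completeness _≟ᴬ_ C using (viable⇒hintikka)

  -- b can label position j of a run of viable labels that starts with φ and reads τ.
  prefixEnd : ℕ → (ℕ → Val A) → Label → Bool
  prefixEnd zero    τ b = viable b ∧ b ∋ root
  prefixEnd (suc j) τ b = viable b ∧ ∃ᵇ λ a → prefixEnd j τ a ∧ Step a b ∧ Match a (τ j)

  goodPrefix : ℕ → (ℕ → Val A) → Bool
  goodPrefix j τ = ∃ᵇ (prefixEnd j τ)

  prefixEnd-suc : ∀ j τ b → T (prefixEnd (suc j) τ b) ⇔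
                  (T (viable b) × ∃ λ a → T (prefixEnd j τ a) × T (Step a b) × T (Match a (τ j)))
  prefixEnd-suc j τ b = mk⇔
    (λ e → let v , s = ∧⁻ e ; a , f = ∃ᵇ⁻ _ s ; ea , g = ∧⁻ f in v , a , ea , ∧⁻ g)
    (λ (v , a , ea , st , mt) →
      ∧⁺ v (∃ᵇ⁺ (λ a → prefixEnd j τ a ∧ Step a b ∧ Match a (τ j)) a (∧⁺ ea (∧⁺ st mt))))

  prefixEnd-viable : ∀ j τ → prefixEnd j τ ⊆ᵇ viable
  prefixEnd-viable zero    τ b e = proj₁ (∧⁻ e)
  prefixEnd-viable (suc j) τ b e = proj₁ (∧⁻ e)

  prefixEnd-cong : ∀ j {τ τ′} → (∀ t → t < j → τ t ≡ τ′ t) → prefixEnd j τ ≗ prefixEnd j τ′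
  prefixEnd-cong zero    τ≡τ′ b = refl
  prefixEnd-cong (suc j) τ≡τ′ b = cong (viable b ∧_) (∃ᵇ-cong λ a →
    cong₂ _∧_ (prefixEnd-cong j (λ t t<j → τ≡τ′ t (m≤n⇒m≤1+n t<j)) a)
              (cong (λ v → Step a b ∧ Match a v) (τ≡τ′ j ≤-refl)))

  goodPrefix-mono : ∀ {j} k τ → j ≤ k → T (goodPrefix k τ) → T (goodPrefix j τ)
  goodPrefix-mono zero    τ z≤n g = g
  goodPrefix-mono (suc k) τ j≤k g with m≤n⇒m<n∨m≡n j≤k
  ... | inj₂ refl = g
  ... | inj₁ j<k with b , e ← ∃ᵇ⁻ (prefixEnd (suc k) τ) g with _ , a , ea , _ ← to (prefixEnd-suc k τ b) e =
    goodPrefix-mono k τ (≤-pred j<k) (∃ᵇ⁺ (prefixEnd k τ) a ea)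

  hintikka-∷ˢ : ∀ {N W a v} → Hintikka N W → T (Local a) → T (Step a (N 0)) → T (Match a v) →
                Hintikka (a ∷ˢ N) (v ∷ˢ W)
  hintikka-∷ˢ {N} {W} {a} H loc st mt = record
    { local = λ { zero → loc ; (suc t) → local t }
    ; step  = λ { zero → st ; (suc t) → step t }
    ; match = λ { zero → mt ; (suc t) → match t }
    ; fair  = fair′
    }
    where
    open Hintikka H
    fair′ : ∀ t i {ψ χ} → formula i ≡ ψ U χ → T ((a ∷ˢ N) t ∋ i) →
            ∃ λ s → t ≤ s × T ((a ∷ˢ N) s ∋ right i)
    fair′ (suc t) i eq p with s , t≤s , r ← fair t i eq p = suc s , s≤s t≤s , r
    fair′ zero    i eq p with T? (a ∋ right i)
    ... | yes r  = zero , z≤n , r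
    ... | no r∉ with s , _ , r ← fair 0 i eq (until-persists st eq p r∉) = suc s , z≤n , r

  prefixEnd⇒hintikka : ∀ j τ b → T (prefixEnd j τ b) → ∀ {N W} → Hintikka N W → N 0 ≡ b →
    Σ (ℕ → Label) λ N′ → Σ (InfTrace A) λ W′ → Hintikka N′ W′ × T (N′ 0 ∋ root) ×
      (∀ t → t < j → W′ t ≡ τ t) × (∀ t → W′ (t + j) ≡ W t)
  prefixEnd⇒hintikka zero τ b e {N} {W} H refl =
    N , W , H , proj₂ (∧⁻ e) , (λ _ ()) , (λ t → cong W (+-identityʳ t))
  prefixEnd⇒hintikka (suc j) τ b e {N} {W} H refl with _ , a , ea , st , mt ← to (prefixEnd-suc j τ b) e
    with N′ , W′ , H′ , r , before , after ←
         prefixEnd⇒hintikka j τ a ea (hintikka-∷ˢ H (viable⇒local (prefixEnd-viable j τ a ea)) st mt) refl =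
    N′ , W′ , H′ , r , before′ , λ t → trans (cong W′ (+-suc t j)) (after (suc t))
    where
    before′ : ∀ t → t < suc j → W′ t ≡ τ t
    before′ t t<j+1 with m≤n⇒m<n∨m≡n (≤-pred t<j+1)
    ... | inj₁ t<j = before t t<j
    ... | inj₂ refl = after 0

  goodPrefix⇒model : ∀ j τ → T (goodPrefix j τ) → ∃ λ W → (∀ t → t < j → W t ≡ τ t) × W ⊨ φ
  goodPrefix⇒model j τ g with b , e ← ∃ᵇ⁻ _ g
                         with N , N0≡b , H ← viable⇒hintikka b (prefixEnd-viable j τ b e)
    with N′ , W′ , H′ , r , before , _ ← prefixEnd⇒hintikka j τ b e H N0≡b =
    W′ , before , subst (Sat W′ 0) formula-root (to (hintikka-truth H′ (formula root) root refl 0) r)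

  model⇒goodPrefix : ∀ j τ W → (∀ t → t < j → W t ≡ τ t) → W ⊨ φ → T (goodPrefix j τ)
  model⇒goodPrefix j τ W agree sat =
    decidable-stable (T? _) (¬¬-map (λ (g , true-g) → ∃ᵇ⁺ _ (g j) (ends g true-g j ≤-refl))
                                    (¬¬-choice j true-label))
    where
    open Soundness _≟ᴬ_ C W
    ends : ∀ g → (∀ t → t ≤ j → TrueAt t (g t)) → ∀ t → t ≤ j → T (prefixEnd t τ (g t))
    ends g true-g zero    _   =
      ∧⁺ (true-survives (cardinality Label) (true-g 0 z≤n)) (from (true-at (true-g 0 z≤n) formula-root) sat)
    ends g true-g (suc t) t<j = from (prefixEnd-suc t τ (g (suc t)))
      (true-survives (cardinality Label) (true-g (suc t) t<j) , g t , ends g true-g t t≤j ,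
       true-step (true-g t t≤j) (true-g (suc t) t<j) ,
       subst (T ∘ Match (g t)) (agree t t<j) (true-match (true-g t t≤j)))
      where
      t≤j : t ≤ j
      t≤j = <⇒≤ t<j

  goodPrefix-correct : ∀ {k} (σ : FinTrace A k) τ → (∀ i → τ (toℕ i) ≡ σ i) →
                       T (goodPrefix k τ) ⇔ σ ⊨ₙ φ
  goodPrefix-correct {k} σ τ τ≡σ = mk⇔
    (λ g bad → let W , agree , sat = goodPrefix⇒model k τ g
               in bad (W , (λ i → trans (agree (toℕ i) (toℕ<n i)) (τ≡σ i)) , sat))
    (λ good → decidable-stable (T? _) λ ¬g →
      good λ { (W , extends , sat) → ¬g (model⇒goodPrefix k τ W (agree W extends) sat) })
    where
    agree : ∀ W → Extends W σ → ∀ t → t < k → W t ≡ τ t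
    agree W extends t t<k = begin
      W t                        ≡⟨ cong W (sym (toℕ-fromℕ< t<k)) ⟩
      W (toℕ (fromℕ< t<k))       ≡⟨ extends (fromℕ< t<k) ⟩
      σ (fromℕ< t<k)             ≡⟨ sym (τ≡σ (fromℕ< t<k)) ⟩
      τ (toℕ (fromℕ< t<k))       ≡⟨ cong τ (toℕ-fromℕ< t<k) ⟩
      τ t                        ∎
      where open ≡-Reasoning

extend : ∀ {X : Set} {m} → (Fin m → X) → X → ℕ → X
extend {m = zero}  w d j       = d
extend {m = suc m} w d zero    = w zero
extend {m = suc m} w d (suc j) = extend (w ∘ suc) d j

extend-toℕ : ∀ {X : Set} {m} (w : Fin m → X) d i → extend w d (toℕ i) ≡ w i
extend-toℕ w d zero    = refl
extend-toℕ w d (suc i) = extend-toℕ (w ∘ suc) d i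

record DFA (Σ′ : Set) (N : ℕ) : Set where
  field
    start  : Fin N
    step   : Fin N → Σ′ → Fin N
    accept : Fin N → Bool

module _ {Σ′ : Set} {N : ℕ} (D : DFA Σ′ N) where

  open DFA D

  runFrom : ∀ {m} → Fin N → (Fin m → Σ′) → Fin N
  runFrom {zero}  s w = s
  runFrom {suc m} s w = runFrom (step s (w zero)) (w ∘ suc)

  iterate : Fin N → (ℕ → Σ′) → ℕ → Fin N
  iterate s W zero    = s
  iterate s W (suc j) = step (iterate s W j) (W j)

  runFrom-iterate : ∀ {m} s (w : Fin m → Σ′) d → runFrom s w ≡ iterate s (extend w d) m
  runFrom-iterate {zero}  s w d = refl
  runFrom-iterate {suc m} s w d = trans (runFrom-iterate (step s (w zero)) (w ∘ suc) d) (shift m)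
    where
    shift : ∀ j → iterate (step s (w zero)) (extend (w ∘ suc) d) j ≡ iterate s (extend w d) (suc j)
    shift zero    = refl
    shift (suc j) = cong (λ s′ → step s′ (extend w d (suc j))) (shift j)

  toNFA : NFA Σ′
  toNFA = record
    { states    = N
    ; initial   = λ s → ⌊ s Fin.≟ start ⌋
    ; δ         = λ s a s′ → ⌊ s′ Fin.≟ step s a ⌋
    ; accepting = accept
    }

  private
    accepted : ∀ {m} s (w : Fin m → Σ′) (r : Fin (suc m) → Fin N) → r zero ≡ s →
               (∀ i → ⌊ r (suc i) Fin.≟ step (r (inject₁ i)) (w i) ⌋ ≡ true) →
               accept (r (fromℕ m)) ≡ true →
               T (accept (runFrom s w))
    accepted {zero}  s w r refl _  acc = from T-≡ acc
    accepted {suc m} s w r refl δr acc =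
      accepted (step s (w zero)) (w ∘ suc) (r ∘ suc) (toWitness (from T-≡ (δr zero))) (δr ∘ suc) acc

    trace : ∀ {m} → Fin N → (Fin m → Σ′) → Fin (suc m) → Fin N
    trace         s w zero    = s
    trace {suc m} s w (suc i) = trace (step s (w zero)) (w ∘ suc) i

    trace-steps : ∀ {m} s (w : Fin m → Σ′) i →
                  ⌊ trace s w (suc i) Fin.≟ step (trace s w (inject₁ i)) (w i) ⌋ ≡ true
    trace-steps s w zero    = to T-≡ (fromWitness refl)
    trace-steps s w (suc i) = trace-steps (step s (w zero)) (w ∘ suc) i

    trace-ends : ∀ {m} s (w : Fin m → Σ′) → trace s w (fromℕ m) ≡ runFrom s w
    trace-ends {zero}  s w = refl
    trace-ends {suc m} s w = trace-ends (step s (w zero)) (w ∘ suc)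

  toNFA-accepts : ∀ {m} (w : Fin m → Σ′) → Accepts toNFA w ⇔ T (accept (runFrom start w))
  toNFA-accepts w = mk⇔
    (λ (r , r₀ , δr , acc) → accepted start w r (toWitness (from T-≡ r₀)) δr acc)
    (λ acc → trace start w , to T-≡ (fromWitness refl) , trace-steps start w ,
             trans (cong accept (trace-ends start w)) (to T-≡ acc))

update : {X : Set} → (ℕ → X) → ℕ → X → ℕ → X
update y j v t with t ≟ j
... | yes _ = v
... | no  _ = y t

update-same : ∀ {X : Set} (y : ℕ → X) j v → update y j v j ≡ v
update-same y j v with j ≟ j
... | yes _   = refl
... | no j≢j = ⊥-elim (j≢j refl)

update-other : ∀ {X : Set} (y : ℕ → X) {j} v {t} → t < j → update y j v t ≡ y t
update-other y {j} v {t} t<j with t ≟ j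
... | yes refl = ⊥-elim (<-irrefl refl t<j)
... | no  _    = refl

module Distinguishability (e p : ℕ) (φ : LTL (Fin e ⊎ Fin p)) where

  open GoodPrefixes (≡-dec Fin._≟_ Fin._≟_) (closure φ)

  Letter : Set
  Letter = Val (Fin e) × Val (Fin e)

  LabelPair : Set
  LabelPair = Label × Label

  _⊔ˢ_ : (ℕ → Val (Fin e)) → (ℕ → Val (Fin p)) → ℕ → Val (Fin e ⊎ Fin p)
  (x ⊔ˢ y) t = join (x t) (y t)

  initialPairs : LabelPair → Bool
  initialPairs (b , b′) = (viable b ∧ b ∋ root) ∧ (viable b′ ∧ b′ ∋ root)

  transition : LabelPair → Letter → LabelPair → Bool
  transition (a , a′) (x , x′) (b , b′) =
    (viable b ∧ viable b′) ∧ (Step a b ∧ Step a′ b′) ∧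
    ∃ᵇ λ (y : Fin (2 ^ p)) → Match a (join x (bits y)) ∧ Match a′ (join x′ (bits y))

  -- Pairs of labels that the two traces can reach while reading a common choice of outputs of p.
  successors : (LabelPair → Bool) → Letter → LabelPair → Bool
  successors R l q = ∃ᵇ λ q₀ → R q₀ ∧ transition q₀ l q

  successors-cong : ∀ {R R′} l → R ≗ R′ → successors R l ≗ successors R′ l
  successors-cong l R≗R′ q = ∃ᵇ-cong λ q₀ → cong (_∧ transition q₀ l q) (R≗R′ q₀)

  jointly : (ℕ → Letter) → ℕ → LabelPair → Bool
  jointly W zero    = initialPairs
  jointly W (suc j) = successors (jointly W j) (W j)

  module _ (W : ℕ → Letter) where

    private
      x x′ : ℕ → Val (Fin e)
      x  = proj₁ ∘ W
      x′ = proj₂ ∘ W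

    jointly⁺ : ∀ j y b b′ → T (prefixEnd j (x ⊔ˢ y) b) → T (prefixEnd j (x′ ⊔ˢ y) b′) →
               T (jointly W j (b , b′))
    jointly⁺ zero    y b b′ e e′ = ∧⁺ e e′
    jointly⁺ (suc j) y b b′ e e′ with v , a , ea , st , mt ← to (prefixEnd-suc j (x ⊔ˢ y) b) e
                                 with v′ , a′ , ea′ , st′ , mt′ ← to (prefixEnd-suc j (x′ ⊔ˢ y) b′) e′ =
      ∃ᵇ⁺ (λ q₀ → jointly W j q₀ ∧ transition q₀ (W j) (b , b′)) (a , a′)
        (∧⁺ (jointly⁺ j y a a′ ea ea′) (∧⁺ (∧⁺ v v′) (∧⁺ (∧⁺ st st′)
          (∃ᵇ⁺ (λ c → Match a (join (x j) (bits c)) ∧ Match a′ (join (x′ j) (bits c))) (fromBits (y j))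
            (∧⁺ (subst T (sym (Match-cong (coded (x j)))) mt) (subst T (sym (Match-cong (coded (x′ j)))) mt′))))))
      where
      coded : ∀ z → join z (bits (fromBits (y j))) ≗ join z (y j)
      coded z (inj₁ _) = refl
      coded z (inj₂ o) = bits-fromBits (y j) o

    jointly⁻ : ∀ j b b′ → T (jointly W j (b , b′)) →
               ∃ λ y → T (prefixEnd j (x ⊔ˢ y) b) × T (prefixEnd j (x′ ⊔ˢ y) b′)
    jointly⁻ zero    b b′ s = (λ _ _ → false) , ∧⁻ s
    jointly⁻ (suc j) b b′ s
      with (a , a′) , r ← ∃ᵇ⁻ (λ q₀ → jointly W j q₀ ∧ transition q₀ (W j) (b , b′)) s
      with ra , tr ← ∧⁻ r
      with y , ea , ea′ ← jointly⁻ j a a′ ra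
      with vs , rest ← ∧⁻ tr with sts , found ← ∧⁻ rest
      with c , ms ← ∃ᵇ⁻ (λ c → Match a (join (x j) (bits c)) ∧ Match a′ (join (x′ j) (bits c))) found =
      y′ , from (prefixEnd-suc j (x ⊔ˢ y′) b)
                (proj₁ (∧⁻ vs) , a , extended x ea , proj₁ (∧⁻ sts) , now x (proj₁ (∧⁻ ms)))
         , from (prefixEnd-suc j (x′ ⊔ˢ y′) b′)
                (proj₂ (∧⁻ vs) , a′ , extended x′ ea′ , proj₂ (∧⁻ sts) , now x′ (proj₂ (∧⁻ ms)))
      where
      y′ : ℕ → Val (Fin p)
      y′ = update y j (bits c)
      extended : ∀ z {a} → T (prefixEnd j (z ⊔ˢ y) a) → T (prefixEnd j (z ⊔ˢ y′) a)
      extended z {a} = subst T (prefixEnd-cong j (λ t t<j → cong (join (z t)) (sym (update-other y (bits c) t<j))) a)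
      now : ∀ z {a} → T (Match a (join (z j) (bits c))) → T (Match a ((z ⊔ˢ y′) j))
      now z {a} = subst (λ v → T (Match a (join (z j) v))) (sym (update-same y j (bits c)))

    jointly-good : ∀ j → T (∃ᵇ (jointly W j)) ⇔
                   ∃ λ y → T (goodPrefix j (x ⊔ˢ y)) × T (goodPrefix j (x′ ⊔ˢ y))
    jointly-good j = mk⇔
      (λ s → let (b , b′) , r = ∃ᵇ⁻ (jointly W j) s ; y , e , e′ = jointly⁻ j b b′ r
             in y , ∃ᵇ⁺ (prefixEnd j (x ⊔ˢ y)) b e , ∃ᵇ⁺ (prefixEnd j (x′ ⊔ˢ y)) b′ e′)
      (λ (y , g , g′) → let b  , e  = ∃ᵇ⁻ (prefixEnd j (x ⊔ˢ y)) g
                            b′ , e′ = ∃ᵇ⁻ (prefixEnd j (x′ ⊔ˢ y)) g′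
                        in ∃ᵇ⁺ (jointly W j) (b , b′) (jointly⁺ j y b b′ e e′))

  private
    K : ℕ
    K = 2 ^ size φ * 2 ^ size φ

  -- A state codes a flag (bit zero), recording whether some pair of labels was jointly
  -- reachable one letter earlier, and the set of jointly reachable pairs.
  flag : Fin (2 ^ suc K) → Bool
  flag c = bits {suc K} c zero

  members : Fin (2 ^ suc K) → LabelPair → Bool
  members c (a , b) = bits {suc K} c (suc (combine a b))

  encodeBits : Bool → (LabelPair → Bool) → Fin (suc K) → Bool
  encodeBits f R zero    = f
  encodeBits f R (suc k) = R (remQuot (2 ^ size φ) k)

  encode : Bool → (LabelPair → Bool) → Fin (2 ^ suc K)
  encode f R = fromBits (encodeBits f R)

  flag-encode : ∀ f R → flag (encode f R) ≡ f
  flag-encode f R = bits-fromBits (encodeBits f R) zero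

  members-encode : ∀ f R → members (encode f R) ≗ R
  members-encode f R (a , b) = trans (bits-fromBits (encodeBits f R) (suc (combine a b))) (cong R (remQuot-combine a b))

  automaton : DFA Letter (2 ^ suc K)
  automaton = record
    { start  = encode true initialPairs
    ; step   = λ c l → encode (∃ᵇ (members c)) (successors (members c) l)
    ; accept = λ c → not (∃ᵇ (members c)) ∧ flag c
    }

  earlier : (ℕ → Letter) → ℕ → Bool
  earlier W zero    = true
  earlier W (suc j) = ∃ᵇ (jointly W j)

  module _ (W : ℕ → Letter) where

    private
      state : ℕ → Fin (2 ^ suc K)
      state = iterate automaton (DFA.start automaton) W

    members-state : ∀ j → members (state j) ≗ jointly W j
    members-state zero    = members-encode true initialPairs
    members-state (suc j) q = trans (members-encode (∃ᵇ (members (state j))) (successors (members (state j)) (W j)) q)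
                                    (successors-cong (W j) (members-state j) q)

    flag-state : ∀ j → flag (state j) ≡ earlier W j
    flag-state zero    = flag-encode true initialPairs
    flag-state (suc j) = trans (flag-encode (∃ᵇ (members (state j))) (successors (members (state j)) (W j)))
                               (∃ᵇ-cong (members-state j))

  Separated : ∀ {m} → FinTrace (Fin e) m → FinTrace (Fin e) m → Set
  Separated {m} π π′ = ∀ (πp : FinTrace (Fin p) m) → ¬ ((π ⊔ πp) ⊨ₙ φ) ⊎ ¬ ((π′ ⊔ πp) ⊨ₙ φ)

  JoinableBefore : ∀ {m} → FinTrace (Fin e) m → FinTrace (Fin e) m → Set
  JoinableBefore {m} π π′ = ∀ n (n<m : n < m) → ∃[ πp′ ] (
    ((prefix n (<⇒≤ n<m) π ⊔ πp′) ⊨ₙ φ) × ((prefix n (<⇒≤ n<m) π′ ⊔ πp′) ⊨ₙ φ))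

  goodPrefix-⊔ : ∀ {k} (π : FinTrace (Fin e) k) (πp : FinTrace (Fin p) k) x y →
                 (∀ i → x (toℕ i) ≡ π i) → (∀ i → y (toℕ i) ≡ πp i) →
                 T (goodPrefix k (x ⊔ˢ y)) ⇔ (π ⊔ πp) ⊨ₙ φ
  goodPrefix-⊔ π πp x y x≡π y≡πp =
    goodPrefix-correct (π ⊔ πp) (x ⊔ˢ y) (λ i → cong₂ join (x≡π i) (y≡πp i))

  letters : ∀ {m} → (Fin m → Letter) → ℕ → Letter
  letters w = extend w ((λ _ → false) , (λ _ → false))

  letters-prefix : ∀ {m} (w : Fin m → Letter) (f : Letter → Val (Fin e)) {n} (n≤m : n ≤ m) i →
                   f (letters w (toℕ i)) ≡ prefix n n≤m (f ∘ w) i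
  letters-prefix w f n≤m i =
    trans (cong (f ∘ letters w) (sym (toℕ-inject≤ i n≤m))) (cong f (extend-toℕ w _ (inject≤ i n≤m)))

  silent : ∀ {k} → FinTrace (Fin p) k → ℕ → Val (Fin p)
  silent πp = extend πp (λ _ → false)

  module _ {m} (w : Fin m → Letter) where

    private
      W : ℕ → Letter
      W = letters w

      good : ∀ (f : Letter → Val (Fin e)) πp →
             T (goodPrefix m ((f ∘ W) ⊔ˢ silent πp)) ⇔ ((f ∘ w) ⊔ πp) ⊨ₙ φ
      good f πp = goodPrefix-⊔ (f ∘ w) πp (f ∘ W) (silent πp) (cong f ∘ extend-toℕ w _) (extend-toℕ πp _)

    separated : T (not (∃ᵇ (jointly W m))) ⇔ Separated (proj₁ ∘ w) (proj₂ ∘ w)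
    separated = mk⇔ sep (λ s → from T-not λ j → let y , g , g′ = to (jointly-good W m) j in
                          Sum.[ (λ bad → bad (to (good′ proj₁ y) g)) , (λ bad → bad (to (good′ proj₂ y) g′)) ]
                                (s (y ∘ toℕ)))
      where
      good′ : ∀ (f : Letter → Val (Fin e)) y →
              T (goodPrefix m ((f ∘ W) ⊔ˢ y)) ⇔ ((f ∘ w) ⊔ (y ∘ toℕ)) ⊨ₙ φ
      good′ f y = goodPrefix-⊔ (f ∘ w) (y ∘ toℕ) (f ∘ W) y (cong f ∘ extend-toℕ w _) (λ _ → refl)
      sep : T (not (∃ᵇ (jointly W m))) → Separated (proj₁ ∘ w) (proj₂ ∘ w)
      sep none πp with T? (goodPrefix m ((proj₁ ∘ W) ⊔ˢ silent πp))
                     | T? (goodPrefix m ((proj₂ ∘ W) ⊔ˢ silent πp))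
      ... | yes g | yes g′ = ⊥-elim (to T-not none (from (jointly-good W m) (silent πp , g , g′)))
      ... | no ¬g | _      = inj₁ (¬g ∘ from (good proj₁ πp))
      ... | _     | no ¬g′ = inj₂ (¬g′ ∘ from (good proj₂ πp))

  joinable : ∀ {m} (w : Fin m → Letter) → T (earlier (letters w) m) ⇔ JoinableBefore (proj₁ ∘ w) (proj₂ ∘ w)
  joinable {zero}  w = mk⇔ (λ _ _ ()) _
  joinable {suc m} w = mk⇔ join-prefixes (λ j → let πp , ok , ok′ = j m ≤-refl in
    from (jointly-good W m) (silent πp , from (good-silent proj₁ πp) ok , from (good-silent proj₂ πp) ok′))
    where
    W : ℕ → Letter
    W = letters w
    good : ∀ (f : Letter → Val (Fin e)) {n} (n≤m : n ≤ suc m) y →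
           T (goodPrefix n ((f ∘ W) ⊔ˢ y)) ⇔ (prefix n n≤m (f ∘ w) ⊔ (y ∘ toℕ)) ⊨ₙ φ
    good f n≤m y = goodPrefix-⊔ _ (y ∘ toℕ) (f ∘ W) y (letters-prefix w f n≤m) (λ _ → refl)
    good-silent : ∀ (f : Letter → Val (Fin e)) πp →
                  T (goodPrefix m ((f ∘ W) ⊔ˢ silent πp)) ⇔ (prefix m (<⇒≤ ≤-refl) (f ∘ w) ⊔ πp) ⊨ₙ φ
    good-silent f πp =
      goodPrefix-⊔ _ πp (f ∘ W) (silent πp) (letters-prefix w f (<⇒≤ ≤-refl)) (extend-toℕ πp _)
    join-prefixes : T (earlier W (suc m)) → JoinableBefore (proj₁ ∘ w) (proj₂ ∘ w)
    join-prefixes j n n<m with y , g , g′ ← to (jointly-good W m) j =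
      y ∘ toℕ , to (good proj₁ (<⇒≤ n<m) y) (goodPrefix-mono m _ (≤-pred n<m) g)
              , to (good proj₂ (<⇒≤ n<m) y) (goodPrefix-mono m _ (≤-pred n<m) g′)

  recognises : ∀ m (w : Fin m → Letter) → Accepts (toNFA automaton) w ⇔ ρ φ (proj₁ ∘ w) (proj₂ ∘ w)
  recognises m w = begin
    Accepts (toNFA automaton) w
      ∼⟨ toNFA-accepts automaton w ⟩
    T (accept (runFrom automaton start w))
      ≡⟨ cong (T ∘ accept) (runFrom-iterate automaton start w _) ⟩
    T (accept (iterate automaton start W m))
      ≡⟨ cong T (cong₂ _∧_ (cong not (∃ᵇ-cong (members-state W m))) (flag-state W m)) ⟩
    T (not (∃ᵇ (jointly W m)) ∧ earlier W m)
      ∼⟨ T-∧ ⟩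
    (T (not (∃ᵇ (jointly W m))) × T (earlier W m))
      ∼⟨ separated w ×-⇔ joinable w ⟩
    ρ φ (proj₁ ∘ w) (proj₂ ∘ w)
      ∎
    where
    open DFA automaton
    open EquationalReasoning
    W : ℕ → Letter
    W = letters w

size-positive : ∀ {A : Set} (φ : LTL A) → 1 ≤ size φ
size-positive φ = ≤-trans (s≤s z≤n) (toℕ<n (Closure.root (closure φ)))

suc-square≤cube : ∀ s → 1 ≤ s → suc (2 ^ s * 2 ^ s) ≤ 2 ^ (3 * s)
suc-square≤cube s 1≤s = begin
  suc (a * a)              ≤⟨ +-monoˡ-≤ (a * a) (*-mono-≤ 1≤a 1≤a) ⟩
  a * a + a * a            ≡⟨ cong (a * a +_) (sym (+-identityʳ (a * a))) ⟩
  2 * (a * a)              ≤⟨ *-monoˡ-≤ (a * a) 2≤a ⟩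
  a * (a * a)              ≡⟨ cong (λ k → a * (a * 2 ^ k)) (sym (+-identityʳ s)) ⟩
  a * (a * 2 ^ (s + 0))    ≡⟨ cong (a *_) (sym (^-distribˡ-+-* 2 s (s + 0))) ⟩
  a * 2 ^ (s + (s + 0))    ≡⟨ sym (^-distribˡ-+-* 2 s (s + (s + 0))) ⟩
  2 ^ (3 * s)              ∎
  where
  open ≤-Reasoning
  a : ℕ
  a = 2 ^ s
  2≤a : 2 ≤ a
  2≤a = ^-monoʳ-≤ 2 1≤s
  1≤a : 1 ≤ a
  1≤a = ≤-trans (s≤s z≤n) 2≤a

theorem1 : ∃[ c ] ((e p : ℕ) (φ : LTL (Fin e ⊎ Fin p)) →
    Σ (NFA (Val (Fin e) × Val (Fin e))) λ A →
      (NFA.states A ≤ 2 ^ (2 ^ (c * size φ)))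
      × (∀ (m : ℕ) (w : Fin m → Val (Fin e) × Val (Fin e)) →
           Accepts A w ⇔ ρ φ (proj₁ ∘ w) (proj₂ ∘ w)))
theorem1 = 3 , λ e p φ → let open Distinguishability e p φ in
  toNFA automaton , ^-monoʳ-≤ 2 (suc-square≤cube (size φ) (size-positive φ)) , recognises
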